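{- Let $T^-\in\Omega^-$ and $T^+\in\Omega^+$. (1) If $T^-\subseteq A$, then $A\in\Omega^-$ and $Fv_2(A)\subseteq Fv_2(T^-)$. (2) If $B\subseteq T^+$, then $B\in\Omega^+$ and $Fv_2(B)\subseteq Fv_2(T^+)$.
   Context: Formulas. Second-order language with individual variables, function symbols (building terms), predicate symbols and predicate variables of every arity, logical symbols $\perp,\rightarrow,\forall,\mu$. Formulas: $\perp$; atomic $X(t_1,\dots,t_n)$ ($X$ predicate variable or symbol); $A\rightarrow B$; $\forall xA$; $\forall XA$; $\mu Cx_1\dots x_nA\langle t_1,\dots,t_n\rangle$ with $C$ an $n$-ary predicate symbol appearing and positive in $A$ ($C,x_1,\dots,x_n$ are bound in it). Positivity of $X$ in $A$: not appearing: both positive and negative; in $X(\bar t)$: positive only; in $B\rightarrow C$: positive (negative) iff negative (positive) in $B$ and positive (negative) in $C$; in $\forall vB$ ($v\ne X$) and $\mu C\bar xB\langle\bar t\rangle$: as in $B$. $A[G/X(x_1,\dots,x_n)]$ replaces each $X(t_1,\dots,t_n)$ by $G[t_1/x_1,\dots,t_n/x_n]$. $Fv_2(A)$ is the set of predicate variables and predicate symbols occurring free in $A$. Relation $\subseteq$ (fixed set $\mathbf E$ of equations between terms; a particular case of an equation of $\mathbf E$ is $u=v$ or $v=u$ with $u,v$ obtained from the two sides of an equation of $\mathbf E$ by one substitution of terms for individual variables): the least relation closed under (ax) $A\subseteq A$; from $A\subseteq A'$, $B\subseteq B'$ infer $A'\rightarrow B\subseteq A\rightarrow B'$; from $A[G/v]\subseteq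 B$ infer $\forall vA\subseteq B$ ($G$ a term if $v$ is an individual variable, a formula if $v$ is a predicate variable); from $A\subseteq B$ infer $A\subseteq\forall vB$ if $v$ not free in $A$; from $A\subseteq B[u/y]$ infer $A\subseteq B[w/y]$ if $u=w$ is a particular case of an equation of $\mathbf E$; transitivity; ($\mu_d$) $D[\mu Cx_1\dots x_mD\langle z_1,\dots,z_m\rangle/C(z_1,\dots,z_m)][t_1/x_1,\dots,t_m/x_m]\subseteq\mu Cx_1\dots x_mD\langle t_1,\dots,t_m\rangle$; ($\mu'_g$) its converse; ($\mu_g$) from $D[F/C(x_1,\dots,x_m)]\subseteq F$ infer $\mu Cx_1\dots x_mD\langle t_1,\dots,t_m\rangle\subseteq F[t_1/x_1,\dots,t_m/x_m]$. $\Omega^+$ ($\forall$-positive types), $\Omega^-$ ($\forall$-negative types): least sets with atomic formulas and $\perp$ in both; $T^-\rightarrow T^+\in\Omega^+$ and $T^+\rightarrow T^-\in\Omega^-$ for $T^\pm\in\Omega^\pm$; $\forall xT^+,\forall XT^+\in\Omega^+$ for $T^+\in\Omega^+$; $\forall xT^-\in\Omega^-$ for $T^-\in\Omega^-$; $\forall XT^-\in\Omega^-$ if moreover $X$ is not free in $T^-$; $\mu Cx_1\dots x_nT^+\langle t_1,\dots,t_n\rangle\in\Omega^+$ if $T^+\in\Omega^+$ and $C$ appears and is positive in $T^+$. -}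

module Defs where

-- Representation (well-scoped de Bruijn syntax):
--  * Term S n      : terms with n individual variables in scope (index 0 = most recently bound).
--  * PCtx          : list of predicate-level names in scope, each tagged with its kind
--                    (predicate variable `pvar` or predicate symbol `psym`) and its arity.
--                    Free predicate variables/symbols are the entries of the outer context;
--                    ∀X binds a `pvar`, μC binds a `psym`.
--  * Fm S Δ n      : formulas.
--  * μ k D ts      : μ C x₁…x_k D ⟨t₁…t_k⟩, where D lives in the context extended by C
--                    (head `here`) and by x₁…x_k (individual indices 0…k-1, x_i = index i-1).

open import Data.Nat using (ℕ; zero; suc; _+_)
open import Data.Fin using (Fin; zero; suc; splitAt; _↑ˡ_; _↑ʳ_)
open import Data.Vec using (Vec; []; _∷_; lookup; tabulate)
open import Data.List using (List; []; _∷_)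
open import Data.Product using (Σ; _×_; _,_; proj₁; proj₂)
open import Data.Sum using (_⊎_; inj₁; inj₂; [_,_]′)
open import Data.Bool using (Bool; true; false; not; T)
open import Data.Unit using (⊤)
open import Data.Empty using (⊥)
open import Relation.Nullary using (¬_)
open import Relation.Binary.PropositionalEquality using (_≡_)

record Sig : Set₁ where
  field
    FunSym : Set
    arity  : FunSym → ℕ
open Sig public

data Kind : Set where
  pvar psym : Kind

PCtx : Set
PCtx = List (Kind × ℕ)

data _∋_ : PCtx → Kind × ℕ → Set where
  here  : ∀ {Δ e} → (e ∷ Δ) ∋ e
  there : ∀ {Δ e e'} → Δ ∋ e → (e' ∷ Δ) ∋ e

ar : ∀ {Δ e} → Δ ∋ e → ℕ
ar {e = e} _ = proj₂ e

sameHead : ∀ {Δ e e'} → Δ ∋ e → Δ ∋ e' → Bool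
sameHead here      here       = true
sameHead (there h) (there h') = sameHead h h'
sameHead _         _          = false

module _ (S : Sig) where

  data Term (n : ℕ) : Set where
    var : Fin n → Term n
    fun : (f : FunSym S) → Vec (Term n) (arity S f) → Term n

  data Fm : PCtx → ℕ → Set where
    ⊥̇    : ∀ {Δ n} → Fm Δ n
    atom : ∀ {Δ n e} → Δ ∋ e → Vec (Term n) (proj₂ e) → Fm Δ n
    _⇒_  : ∀ {Δ n} → Fm Δ n → Fm Δ n → Fm Δ n
    ∀i   : ∀ {Δ n} → Fm Δ (suc n) → Fm Δ n
    ∀p   : ∀ {Δ n} (k : ℕ) → Fm ((pvar , k) ∷ Δ) n → Fm Δ n
    μ    : ∀ {Δ n} (k : ℕ) → Fm ((psym , k) ∷ Δ) (k + n)
           → Vec (Term n) k → Fm Δ n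

module _ {S : Sig} where

  mutual
    substT : ∀ {m n} → (Fin m → Term S n) → Term S m → Term S n
    substT σ (var i)    = σ i
    substT σ (fun f ts) = fun f (substTs σ ts)

    substTs : ∀ {m n k} → (Fin m → Term S n) → Vec (Term S m) k → Vec (Term S n) k
    substTs σ []       = []
    substTs σ (t ∷ ts) = substT σ t ∷ substTs σ ts

  renT : ∀ {m n} → (Fin m → Fin n) → Term S m → Term S n
  renT ρ = substT (λ i → var (ρ i))

  liftBy : ∀ {m n} (k : ℕ) → (Fin m → Fin n) → Fin (k + m) → Fin (k + n)
  liftBy {n = n} k ρ i = [ (λ j → j ↑ˡ n) , (λ j → k ↑ʳ ρ j) ]′ (splitAt k i)

  liftsBy : ∀ {m n} (k : ℕ) → (Fin m → Term S n) → Fin (k + m) → Term S (k + n)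
  liftsBy {n = n} k σ i = [ (λ j → var (j ↑ˡ n)) , (λ j → renT (k ↑ʳ_) (σ j)) ]′ (splitAt k i)

  substF : ∀ {Δ m n} → (Fin m → Term S n) → Fm S Δ m → Fm S Δ n
  substF σ ⊥̇          = ⊥̇
  substF σ (atom h ts) = atom h (substTs σ ts)
  substF σ (A ⇒ B)     = substF σ A ⇒ substF σ B
  substF σ (∀i A)      = ∀i (substF (liftsBy 1 σ) A)
  substF σ (∀p k A)    = ∀p k (substF σ A)
  substF σ (μ k D ts)  = μ k (substF (liftsBy k σ) D) (substTs σ ts)

  renF : ∀ {Δ m n} → (Fin m → Fin n) → Fm S Δ m → Fm S Δ n
  renF ρ = substF (λ i → var (ρ i))

  sub0 : ∀ {n} → Term S n → Fin (suc n) → Term S n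
  sub0 u zero    = u
  sub0 u (suc i) = var i

  -- t̄ / x̄ (the first k indices), other variables shifted down
  args : ∀ {n k} → Vec (Term S n) k → Fin (k + n) → Term S n
  args {k = k} ts i = [ (λ j → lookup ts j) , var ]′ (splitAt k i)

  idArgs : ∀ {n} k → Vec (Term S (k + n)) k
  idArgs {n} k = tabulate (λ j → var (j ↑ˡ n))

  HRen : PCtx → PCtx → Set
  HRen Δ Δ' = ∀ {e} → Δ ∋ e → Δ' ∋ e

  liftH : ∀ {Δ Δ' e'} → HRen Δ Δ' → HRen (e' ∷ Δ) (e' ∷ Δ')
  liftH ρ here      = here
  liftH ρ (there h) = there (ρ h)

  renH : ∀ {Δ Δ' n} → HRen Δ Δ' → Fm S Δ n → Fm S Δ' n
  renH ρ ⊥̇          = ⊥̇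
  renH ρ (atom h ts) = atom (ρ h) ts
  renH ρ (A ⇒ B)     = renH ρ A ⇒ renH ρ B
  renH ρ (∀i A)      = ∀i (renH ρ A)
  renH ρ (∀p k A)    = ∀p k (renH (liftH ρ) A)
  renH ρ (μ k D ts)  = μ k (renH (liftH ρ) D) ts

  -- simultaneous substitution of formula abstractions for predicate heads:
  -- a head h of arity k is mapped to a formula whose first k individual
  -- indices are the abstracted variables x₁…x_k.
  PSub : PCtx → PCtx → ℕ → Set
  PSub Δ Δ' n = ∀ {e} → (h : Δ ∋ e) → Fm S Δ' (proj₂ e + n)

  liftPI : ∀ {Δ Δ' n} (k : ℕ) → PSub Δ Δ' n → PSub Δ Δ' (k + n)
  liftPI k σ h = renF (liftBy (ar h) (k ↑ʳ_)) (σ h)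

  liftPH : ∀ {Δ Δ' n e'} → PSub Δ Δ' n → PSub (e' ∷ Δ) (e' ∷ Δ') n
  liftPH {e' = e'} σ here      = atom here (idArgs (proj₂ e'))
  liftPH           σ (there h) = renH there (σ h)

  psubst : ∀ {Δ Δ' n} → Fm S Δ n → PSub Δ Δ' n → Fm S Δ' n
  psubst ⊥̇          σ = ⊥̇
  psubst (atom h ts) σ = substF (args ts) (σ h)
  psubst (A ⇒ B)     σ = psubst A σ ⇒ psubst B σ
  psubst (∀i A)      σ = ∀i (psubst A (liftPI 1 σ))
  psubst (∀p k A)    σ = ∀p k (psubst A (liftPH σ))
  psubst (μ k D ts)  σ = μ k (psubst D (liftPI k (liftPH σ))) ts

  -- A[G/X(x₁…x_k)] where X is head `here`
  _[_/X] : ∀ {Δ n e} → Fm S (e ∷ Δ) n → Fm S Δ (proj₂ e + n) → Fm S Δ n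
  _[_/X] {Δ} {n} {e} A G = psubst A σ
    where
      σ : PSub (e ∷ Δ) Δ n
      σ here      = G
      σ (there h) = atom h (idArgs (ar h))

  -- an abstraction F (free x̄ = first k indices, rest of scope n) seen as a
  -- substitute for C(x̄) inside a body whose scope is k + n (x̄ then the outer n)
  absF : ∀ {Δ n} (k : ℕ) → Fm S Δ (k + n) → Fm S Δ (k + (k + n))
  absF k F = renF (liftBy k (k ↑ʳ_)) F

  -- μ C x̄ D ⟨z̄⟩ with z̄ the first k indices of scope k + n
  μz : ∀ {Δ n} (k : ℕ) → Fm S ((psym , k) ∷ Δ) (k + n) → Fm S Δ (k + n)
  μz k D = μ k (renF (liftBy k (k ↑ʳ_)) D) (idArgs k)

  Occ : ∀ {Δ n e} → Δ ∋ e → Fm S Δ n → Set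
  Occ h ⊥̇           = ⊥
  Occ h (atom h' ts) = T (sameHead h h')
  Occ h (A ⇒ B)      = Occ h A ⊎ Occ h B
  Occ h (∀i A)       = Occ h A
  Occ h (∀p k A)     = Occ (there h) A
  Occ h (μ k D ts)   = Occ (there h) D

  mutual
    Pos : ∀ {Δ n e} → Δ ∋ e → Fm S Δ n → Set
    Pos h ⊥̇           = ⊤
    Pos h (atom h' ts) = ⊤
    Pos h (A ⇒ B)      = Neg h A × Pos h B
    Pos h (∀i A)       = Pos h A
    Pos h (∀p k A)     = Pos (there h) A
    Pos h (μ k D ts)   = Pos (there h) D

    Neg : ∀ {Δ n e} → Δ ∋ e → Fm S Δ n → Set
    Neg h ⊥̇           = ⊤
    Neg h (atom h' ts) = T (not (sameHead h h'))
    Neg h (A ⇒ B)      = Pos h A × Neg h B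
    Neg h (∀i A)       = Neg h A
    Neg h (∀p k A)     = Neg (there h) A
    Neg h (μ k D ts)   = Neg (there h) D

  WF : ∀ {Δ n} → Fm S Δ n → Set
  WF ⊥̇          = ⊤
  WF (atom h ts) = ⊤
  WF (A ⇒ B)     = WF A × WF B
  WF (∀i A)      = WF A
  WF (∀p k A)    = WF A
  WF (μ k D ts)  = Occ here D × Pos here D × WF D

  Fv₂⊆ : ∀ {Δ n} → Fm S Δ n → Fm S Δ n → Set
  Fv₂⊆ {Δ} A B = ∀ {e} (h : Δ ∋ e) → Occ h A → Occ h B

  mutual
    data Ω⁺ : ∀ {Δ n} → Fm S Δ n → Set where
      atom⁺ : ∀ {Δ n e} (h : Δ ∋ e) (ts : Vec (Term S n) (proj₂ e)) → Ω⁺ (atom h ts)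
      ⊥⁺    : ∀ {Δ n} → Ω⁺ {Δ} {n} ⊥̇
      ⇒⁺    : ∀ {Δ n} {A B : Fm S Δ n} → Ω⁻ A → Ω⁺ B → Ω⁺ (A ⇒ B)
      ∀i⁺   : ∀ {Δ n} {A : Fm S Δ (suc n)} → Ω⁺ A → Ω⁺ (∀i A)
      ∀p⁺   : ∀ {Δ n k} {A : Fm S ((pvar , k) ∷ Δ) n} → Ω⁺ A → Ω⁺ (∀p k A)
      μ⁺    : ∀ {Δ n k} {D : Fm S ((psym , k) ∷ Δ) (k + n)} {ts : Vec (Term S n) k}
              → Ω⁺ D → Occ here D → Pos here D → Ω⁺ (μ k D ts)

    data Ω⁻ : ∀ {Δ n} → Fm S Δ n → Set where
      atom⁻ : ∀ {Δ n e} (h : Δ ∋ e) (ts : Vec (Term S n) (proj₂ e)) → Ω⁻ (atom h ts)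
      ⊥⁻    : ∀ {Δ n} → Ω⁻ {Δ} {n} ⊥̇
      ⇒⁻    : ∀ {Δ n} {A B : Fm S Δ n} → Ω⁺ A → Ω⁻ B → Ω⁻ (A ⇒ B)
      ∀i⁻   : ∀ {Δ n} {A : Fm S Δ (suc n)} → Ω⁻ A → Ω⁻ (∀i A)
      ∀p⁻   : ∀ {Δ n k} {A : Fm S ((pvar , k) ∷ Δ) n} → Ω⁻ A → ¬ Occ here A → Ω⁻ (∀p k A)

-- a set E of equations between terms: E m l r means "l = r" is in E,
-- l and r having (at most) m individual variables
Eqns : Sig → Set₁
Eqns S = (m : ℕ) → Term S m → Term S m → Set

module _ {S : Sig} (E : Eqns S) where

  PartEq : ∀ {n} → Term S n → Term S n → Set
  PartEq {n} u w =
    Σ ℕ λ m → Σ (Term S m) λ l → Σ (Term S m) λ r → E m l r ×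
    Σ (Fin m → Term S n) λ σ →
      (u ≡ substT σ l × w ≡ substT σ r) ⊎ (u ≡ substT σ r × w ≡ substT σ l)

  data _⊆_ : ∀ {Δ n} → Fm S Δ n → Fm S Δ n → Set where
    ax   : ∀ {Δ n} {A : Fm S Δ n} → WF A → A ⊆ A
    arr  : ∀ {Δ n} {A A' B B' : Fm S Δ n} → WF (A' ⇒ B) → WF (A ⇒ B')
           → A ⊆ A' → B ⊆ B' → (A' ⇒ B) ⊆ (A ⇒ B')
    ∀Li  : ∀ {Δ n} {A : Fm S Δ (suc n)} {B : Fm S Δ n} (u : Term S n)
           → WF (∀i A) → WF B
           → substF (sub0 u) A ⊆ B → ∀i A ⊆ B
    ∀Lp  : ∀ {Δ n k} {A : Fm S ((pvar , k) ∷ Δ) n} {B : Fm S Δ n} (G : Fm S Δ (k + n))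
           → WF G → WF (∀p k A) → WF B
           → (A [ G /X]) ⊆ B → ∀p k A ⊆ B
    ∀Ri  : ∀ {Δ n} {A : Fm S Δ n} {B : Fm S Δ (suc n)} → WF A → WF (∀i B)
           → renF suc A ⊆ B → A ⊆ ∀i B
    ∀Rp  : ∀ {Δ n k} {A : Fm S Δ n} {B : Fm S ((pvar , k) ∷ Δ) n} → WF A → WF (∀p k B)
           → renH there A ⊆ B → A ⊆ ∀p k B
    eqn  : ∀ {Δ n} {A : Fm S Δ n} (B : Fm S Δ (suc n)) (u w : Term S n) → PartEq u w
           → WF A → WF (substF (sub0 w) B)
           → A ⊆ substF (sub0 u) B → A ⊆ substF (sub0 w) B
    tr   : ∀ {Δ n} {A B C : Fm S Δ n} → WF A → WF C → A ⊆ B → B ⊆ C → A ⊆ C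
    μd   : ∀ {Δ n k} (D : Fm S ((psym , k) ∷ Δ) (k + n)) (ts : Vec (Term S n) k)
           → WF (substF (args ts) (D [ absF k (μz k D) /X])) → WF (μ k D ts)
           → substF (args ts) (D [ absF k (μz k D) /X]) ⊆ μ k D ts
    μg'  : ∀ {Δ n k} (D : Fm S ((psym , k) ∷ Δ) (k + n)) (ts : Vec (Term S n) k)
           → WF (μ k D ts) → WF (substF (args ts) (D [ absF k (μz k D) /X]))
           → μ k D ts ⊆ substF (args ts) (D [ absF k (μz k D) /X])
    μg   : ∀ {Δ n k} (D : Fm S ((psym , k) ∷ Δ) (k + n)) (F : Fm S Δ (k + n))
           (ts : Vec (Term S n) k)
           → WF (μ k D ts) → WF (substF (args ts) F)
           → (D [ absF k F /X]) ⊆ F → μ k D ts ⊆ substF (args ts) F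

module Submission where

-- By induction on the derivation of X ⊆ Y we show the invariant
--   Transfers X Y :  (X ∈ Ω⁻ ⇒ Y ∈ Ω⁻ ∧ Fv₂(Y) ⊆ Fv₂(X))
--                  ∧ (Y ∈ Ω⁺ ⇒ X ∈ Ω⁺ ∧ Fv₂(X) ⊆ Fv₂(Y)),
-- with one closure lemma per rule of ⊆.  The rules transform formulas only
-- by three kinds of substitution, whose interaction with occurrence,
-- polarity and Ω± is studied first:
--  * substituting terms for individual variables changes none of them;
--  * renaming predicate heads preserves and reflects all of them;
--  * substituting formulas for predicate heads (psubst) always reflects Ω±,
--    preserves Ω± when one head is replaced, at positive places only, by a
--    ∀-positive formula and all other heads by atoms, and can never produce a
--    ∀-negative formula once a μ is put at a positive place.  The ∀-negative half is
-- vacuous for the μ-rules: Ω⁻ contains no μ, and no unfolding is ∀-negative.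

open import Defs
open import Data.Product using (Σ; _×_; _,_; proj₁; proj₂)
open import Data.Nat using (ℕ; suc; _+_)
open import Data.Fin using (Fin)
open import Data.Vec using (Vec)
open import Data.List using (_∷_)
open import Data.Sum using (_⊎_; inj₁; inj₂)
open import Data.Bool using (true; false; not; T; T?)
open import Data.Unit using (⊤; tt)
open import Data.Empty using (⊥; ⊥-elim)
open import Function using (id)
open import Relation.Nullary using (¬_; yes; no)
open import Relation.Binary.PropositionalEquality using (_≡_; refl; cong₂; subst; sym)

-- Transport along an equation between types; the invariance lemmas for
-- individual substitution below are such equations.
coe : ∀ {A B : Set} → A ≡ B → A → B
coe = subst id

coe⁻ : ∀ {A B : Set} → A ≡ B → B → A
coe⁻ eq = subst id (sym eq)

T-not-absurd : ∀ b → T b → T (not b) → ⊥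
T-not-absurd true _ ()

¬T⇒T-not : ∀ b → ¬ T b → T (not b)
¬T⇒T-not true ¬t = ⊥-elim (¬t tt)
¬T⇒T-not false _ = tt

T-not-contrapositive : ∀ b c → (T b → T c) → T (not c) → T (not b)
T-not-contrapositive false _ _ _ = tt
T-not-contrapositive true true f ()
T-not-contrapositive true false f t = f tt

sameHead-refl : ∀ {Δ e} (h : Δ ∋ e) → T (sameHead h h)
sameHead-refl here = tt
sameHead-refl (there h) = sameHead-refl h

sameHead-sound : ∀ {Δ e e'} (a : Δ ∋ e) (b : Δ ∋ e') → T (sameHead a b)
               → _≡_ {A = Σ (Kind × ℕ) (Δ ∋_)} (e , a) (e' , b)
sameHead-sound here here _ = refl
sameHead-sound (there a) (there b) s with sameHead-sound a b s
... | refl = refl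

sameHead-transport : ∀ {Δ e e'} (P : ∀ {e} → Δ ∋ e → Set) {a : Δ ∋ e} {b : Δ ∋ e'}
                   → T (sameHead a b) → P b → P a
sameHead-transport P {a} {b} s x with sameHead-sound a b s
... | refl = x

sameHead-ren : ∀ {Δ Δ' e e'} (ρ : ∀ {e} → Δ ∋ e → Δ' ∋ e) (a : Δ ∋ e) (b : Δ ∋ e')
             → T (sameHead a b) → T (sameHead (ρ a) (ρ b))
sameHead-ren ρ a b s with sameHead-sound a b s
... | refl = sameHead-refl (ρ a)

module _ {S : Sig} where

  -- Substitution of terms for individual variables

  occ-substF : ∀ {Δ m n e} (h : Δ ∋ e) (σ : Fin m → Term S n) (A : Fm S Δ m)
             → Occ h (substF σ A) ≡ Occ h A
  occ-substF h σ ⊥̇ = refl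
  occ-substF h σ (atom h' ts) = refl
  occ-substF h σ (A ⇒ B) = cong₂ _⊎_ (occ-substF h σ A) (occ-substF h σ B)
  occ-substF h σ (∀i A) = occ-substF h (liftsBy 1 σ) A
  occ-substF h σ (∀p k A) = occ-substF (there h) σ A
  occ-substF h σ (μ k D ts) = occ-substF (there h) (liftsBy k σ) D

  mutual
    pos-substF : ∀ {Δ m n e} (h : Δ ∋ e) (σ : Fin m → Term S n) (A : Fm S Δ m)
               → Pos h (substF σ A) ≡ Pos h A
    pos-substF h σ ⊥̇ = refl
    pos-substF h σ (atom h' ts) = refl
    pos-substF h σ (A ⇒ B) = cong₂ _×_ (neg-substF h σ A) (pos-substF h σ B)
    pos-substF h σ (∀i A) = pos-substF h (liftsBy 1 σ) A
    pos-substF h σ (∀p k A) = pos-substF (there h) σ A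
    pos-substF h σ (μ k D ts) = pos-substF (there h) (liftsBy k σ) D

    neg-substF : ∀ {Δ m n e} (h : Δ ∋ e) (σ : Fin m → Term S n) (A : Fm S Δ m)
               → Neg h (substF σ A) ≡ Neg h A
    neg-substF h σ ⊥̇ = refl
    neg-substF h σ (atom h' ts) = refl
    neg-substF h σ (A ⇒ B) = cong₂ _×_ (pos-substF h σ A) (neg-substF h σ B)
    neg-substF h σ (∀i A) = neg-substF h (liftsBy 1 σ) A
    neg-substF h σ (∀p k A) = neg-substF (there h) σ A
    neg-substF h σ (μ k D ts) = neg-substF (there h) (liftsBy k σ) D

  mutual
    Ω⁺-substF : ∀ {Δ m n} (σ : Fin m → Term S n) {A : Fm S Δ m} → Ω⁺ A → Ω⁺ (substF σ A)
    Ω⁺-substF σ (atom⁺ h ts) = atom⁺ h _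
    Ω⁺-substF σ ⊥⁺ = ⊥⁺
    Ω⁺-substF σ (⇒⁺ a b) = ⇒⁺ (Ω⁻-substF σ a) (Ω⁺-substF σ b)
    Ω⁺-substF σ (∀i⁺ a) = ∀i⁺ (Ω⁺-substF _ a)
    Ω⁺-substF σ (∀p⁺ a) = ∀p⁺ (Ω⁺-substF σ a)
    Ω⁺-substF σ (μ⁺ {k = k} {D = D} a o p) =
      μ⁺ (Ω⁺-substF _ a) (coe⁻ (occ-substF here (liftsBy k σ) D) o)
         (coe⁻ (pos-substF here (liftsBy k σ) D) p)

    Ω⁻-substF : ∀ {Δ m n} (σ : Fin m → Term S n) {A : Fm S Δ m} → Ω⁻ A → Ω⁻ (substF σ A)
    Ω⁻-substF σ (atom⁻ h ts) = atom⁻ h _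
    Ω⁻-substF σ ⊥⁻ = ⊥⁻
    Ω⁻-substF σ (⇒⁻ a b) = ⇒⁻ (Ω⁺-substF σ a) (Ω⁻-substF σ b)
    Ω⁻-substF σ (∀i⁻ a) = ∀i⁻ (Ω⁻-substF _ a)
    Ω⁻-substF σ (∀p⁻ {A = A} a X∉A) = ∀p⁻ (Ω⁻-substF σ a) (λ o → X∉A (coe (occ-substF here σ A) o))

  mutual
    Ω⁺-substF⁻¹ : ∀ {Δ m n} (σ : Fin m → Term S n) (A : Fm S Δ m) → Ω⁺ (substF σ A) → Ω⁺ A
    Ω⁺-substF⁻¹ σ ⊥̇ _ = ⊥⁺
    Ω⁺-substF⁻¹ σ (atom h ts) _ = atom⁺ h ts
    Ω⁺-substF⁻¹ σ (A ⇒ B) (⇒⁺ a b) = ⇒⁺ (Ω⁻-substF⁻¹ σ A a) (Ω⁺-substF⁻¹ σ B b)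
    Ω⁺-substF⁻¹ σ (∀i A) (∀i⁺ a) = ∀i⁺ (Ω⁺-substF⁻¹ _ A a)
    Ω⁺-substF⁻¹ σ (∀p k A) (∀p⁺ a) = ∀p⁺ (Ω⁺-substF⁻¹ σ A a)
    Ω⁺-substF⁻¹ σ (μ k D ts) (μ⁺ a o p) =
      μ⁺ (Ω⁺-substF⁻¹ _ D a) (coe (occ-substF here (liftsBy k σ) D) o)
         (coe (pos-substF here (liftsBy k σ) D) p)

    Ω⁻-substF⁻¹ : ∀ {Δ m n} (σ : Fin m → Term S n) (A : Fm S Δ m) → Ω⁻ (substF σ A) → Ω⁻ A
    Ω⁻-substF⁻¹ σ ⊥̇ _ = ⊥⁻
    Ω⁻-substF⁻¹ σ (atom h ts) _ = atom⁻ h ts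
    Ω⁻-substF⁻¹ σ (A ⇒ B) (⇒⁻ a b) = ⇒⁻ (Ω⁺-substF⁻¹ σ A a) (Ω⁻-substF⁻¹ σ B b)
    Ω⁻-substF⁻¹ σ (∀i A) (∀i⁻ a) = ∀i⁻ (Ω⁻-substF⁻¹ _ A a)
    Ω⁻-substF⁻¹ σ (∀p k A) (∀p⁻ a X∉A) =
      ∀p⁻ (Ω⁻-substF⁻¹ σ A a) (λ o → X∉A (coe⁻ (occ-substF here σ A) o))
    Ω⁻-substF⁻¹ σ (μ k D ts) ()

  -- Renaming of predicate heads

  occ-renH : ∀ {Δ Δ' n e} (ρ : HRen {S} Δ Δ') (h : Δ ∋ e) (A : Fm S Δ n)
           → Occ h A → Occ (ρ h) (renH ρ A)
  occ-renH ρ h ⊥̇ ()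
  occ-renH ρ h (atom h₀ ts) o = sameHead-ren ρ h h₀ o
  occ-renH ρ h (A ⇒ B) (inj₁ o) = inj₁ (occ-renH ρ h A o)
  occ-renH ρ h (A ⇒ B) (inj₂ o) = inj₂ (occ-renH ρ h B o)
  occ-renH ρ h (∀i A) o = occ-renH ρ h A o
  occ-renH ρ h (∀p k A) o = occ-renH (liftH {S = S} ρ) (there h) A o
  occ-renH ρ h (μ k D ts) o = occ-renH (liftH {S = S} ρ) (there h) D o

  Preimage : ∀ {Δ Δ' n e'} (ρ : HRen {S} Δ Δ') (h' : Δ' ∋ e') (A : Fm S Δ n) → Set
  Preimage {Δ} ρ h' A = Σ (Kind × ℕ) λ e → Σ (Δ ∋ e) λ h → Occ h A × T (sameHead h' (ρ h))

  occ-renH⁻¹ : ∀ {Δ Δ' n e'} (ρ : HRen {S} Δ Δ') (h' : Δ' ∋ e') (A : Fm S Δ n)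
             → Occ h' (renH ρ A) → Preimage ρ h' A
  occ-renH⁻¹ ρ h' ⊥̇ ()
  occ-renH⁻¹ ρ h' (atom h₀ ts) o = _ , h₀ , sameHead-refl h₀ , o
  occ-renH⁻¹ ρ h' (A ⇒ B) (inj₁ o) with occ-renH⁻¹ ρ h' A o
  ... | e , h , oA , s = e , h , inj₁ oA , s
  occ-renH⁻¹ ρ h' (A ⇒ B) (inj₂ o) with occ-renH⁻¹ ρ h' B o
  ... | e , h , oB , s = e , h , inj₂ oB , s
  occ-renH⁻¹ ρ h' (∀i A) o = occ-renH⁻¹ ρ h' A o
  occ-renH⁻¹ ρ h' (∀p k A) o with occ-renH⁻¹ (liftH {S = S} ρ) (there h') A o
  ... | e , there h , oA , s = e , h , oA , s
  occ-renH⁻¹ ρ h' (μ k D ts) o with occ-renH⁻¹ (liftH {S = S} ρ) (there h') D o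
  ... | e , there h , oD , s = e , h , oD , s

  here∉weaken : ∀ {Δ n e} (A : Fm S Δ n) → ¬ Occ (here {Δ} {e}) (renH there A)
  here∉weaken A o with occ-renH⁻¹ there here A o
  ... | _ , _ , _ , ()

  OnlyPreimage : ∀ {Δ Δ' e e'} (ρ : HRen {S} Δ Δ') (h : Δ ∋ e) (h' : Δ' ∋ e') → Set
  OnlyPreimage {Δ} ρ h h' = ∀ {e₀} (b : Δ ∋ e₀) → T (sameHead h' (ρ b)) → T (sameHead h b)

  here-onlyPreimage : ∀ {Δ Δ' e} (ρ : HRen {S} Δ Δ') → OnlyPreimage (liftH {S = S} {e' = e} ρ) here here
  here-onlyPreimage ρ here s = tt

  occ-renH-back : ∀ {Δ Δ' n e} (ρ : HRen {S} Δ Δ') (h : Δ ∋ e) (A : Fm S Δ n)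
                → OnlyPreimage ρ h (ρ h) → Occ (ρ h) (renH ρ A) → Occ h A
  occ-renH-back ρ h A only o with occ-renH⁻¹ ρ (ρ h) A o
  ... | _ , b , oA , s = sameHead-transport (λ x → Occ x A) (only b s) oA

  onlyPreimage-liftH : ∀ {Δ Δ' e e' e₁} (ρ : HRen {S} Δ Δ') (h : Δ ∋ e) (h' : Δ' ∋ e')
                     → OnlyPreimage ρ h h' → OnlyPreimage (liftH {S = S} {e' = e₁} ρ) (there h) (there h')
  onlyPreimage-liftH ρ h h' only here ()
  onlyPreimage-liftH ρ h h' only (there b) s = only b s

  mutual
    pos-renH : ∀ {Δ Δ' n e e'} (ρ : HRen {S} Δ Δ') (h : Δ ∋ e) (h' : Δ' ∋ e') (A : Fm S Δ n)
             → OnlyPreimage ρ h h' → Pos h A → Pos h' (renH ρ A)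
    pos-renH ρ h h' ⊥̇ only p = tt
    pos-renH ρ h h' (atom h₀ ts) only p = tt
    pos-renH ρ h h' (A ⇒ B) only (n , p) = neg-renH ρ h h' A only n , pos-renH ρ h h' B only p
    pos-renH ρ h h' (∀i A) only p = pos-renH ρ h h' A only p
    pos-renH ρ h h' (∀p k A) only p =
      pos-renH (liftH {S = S} ρ) (there h) (there h') A (onlyPreimage-liftH ρ h h' only) p
    pos-renH ρ h h' (μ k D ts) only p =
      pos-renH (liftH {S = S} ρ) (there h) (there h') D (onlyPreimage-liftH ρ h h' only) p

    neg-renH : ∀ {Δ Δ' n e e'} (ρ : HRen {S} Δ Δ') (h : Δ ∋ e) (h' : Δ' ∋ e') (A : Fm S Δ n)
             → OnlyPreimage ρ h h' → Neg h A → Neg h' (renH ρ A)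
    neg-renH ρ h h' ⊥̇ only p = tt
    neg-renH ρ h h' (atom h₀ ts) only p =
      T-not-contrapositive (sameHead h' (ρ h₀)) (sameHead h h₀) (only h₀) p
    neg-renH ρ h h' (A ⇒ B) only (n , p) = pos-renH ρ h h' A only n , neg-renH ρ h h' B only p
    neg-renH ρ h h' (∀i A) only p = neg-renH ρ h h' A only p
    neg-renH ρ h h' (∀p k A) only p =
      neg-renH (liftH {S = S} ρ) (there h) (there h') A (onlyPreimage-liftH ρ h h' only) p
    neg-renH ρ h h' (μ k D ts) only p =
      neg-renH (liftH {S = S} ρ) (there h) (there h') D (onlyPreimage-liftH ρ h h' only) p

  mutual
    pos-renH⁻¹ : ∀ {Δ Δ' n e} (ρ : HRen {S} Δ Δ') (h : Δ ∋ e) (A : Fm S Δ n)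
               → Pos (ρ h) (renH ρ A) → Pos h A
    pos-renH⁻¹ ρ h ⊥̇ p = tt
    pos-renH⁻¹ ρ h (atom h₀ ts) p = tt
    pos-renH⁻¹ ρ h (A ⇒ B) (n , p) = neg-renH⁻¹ ρ h A n , pos-renH⁻¹ ρ h B p
    pos-renH⁻¹ ρ h (∀i A) p = pos-renH⁻¹ ρ h A p
    pos-renH⁻¹ ρ h (∀p k A) p = pos-renH⁻¹ (liftH {S = S} ρ) (there h) A p
    pos-renH⁻¹ ρ h (μ k D ts) p = pos-renH⁻¹ (liftH {S = S} ρ) (there h) D p

    neg-renH⁻¹ : ∀ {Δ Δ' n e} (ρ : HRen {S} Δ Δ') (h : Δ ∋ e) (A : Fm S Δ n)
               → Neg (ρ h) (renH ρ A) → Neg h A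
    neg-renH⁻¹ ρ h ⊥̇ p = tt
    neg-renH⁻¹ ρ h (atom h₀ ts) p =
      T-not-contrapositive (sameHead h h₀) (sameHead (ρ h) (ρ h₀)) (sameHead-ren ρ h h₀) p
    neg-renH⁻¹ ρ h (A ⇒ B) (n , p) = pos-renH⁻¹ ρ h A n , neg-renH⁻¹ ρ h B p
    neg-renH⁻¹ ρ h (∀i A) p = neg-renH⁻¹ ρ h A p
    neg-renH⁻¹ ρ h (∀p k A) p = neg-renH⁻¹ (liftH {S = S} ρ) (there h) A p
    neg-renH⁻¹ ρ h (μ k D ts) p = neg-renH⁻¹ (liftH {S = S} ρ) (there h) D p

  mutual
    Ω⁺-renH : ∀ {Δ Δ' n} (ρ : HRen {S} Δ Δ') {A : Fm S Δ n} → Ω⁺ A → Ω⁺ (renH ρ A)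
    Ω⁺-renH ρ (atom⁺ h ts) = atom⁺ (ρ h) ts
    Ω⁺-renH ρ ⊥⁺ = ⊥⁺
    Ω⁺-renH ρ (⇒⁺ a b) = ⇒⁺ (Ω⁻-renH ρ a) (Ω⁺-renH ρ b)
    Ω⁺-renH ρ (∀i⁺ a) = ∀i⁺ (Ω⁺-renH ρ a)
    Ω⁺-renH ρ (∀p⁺ a) = ∀p⁺ (Ω⁺-renH (liftH {S = S} ρ) a)
    Ω⁺-renH ρ (μ⁺ {D = D} a o p) =
      μ⁺ (Ω⁺-renH (liftH {S = S} ρ) a) (occ-renH (liftH {S = S} ρ) here D o)
         (pos-renH (liftH {S = S} ρ) here here D (here-onlyPreimage ρ) p)

    Ω⁻-renH : ∀ {Δ Δ' n} (ρ : HRen {S} Δ Δ') {A : Fm S Δ n} → Ω⁻ A → Ω⁻ (renH ρ A)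
    Ω⁻-renH ρ (atom⁻ h ts) = atom⁻ (ρ h) ts
    Ω⁻-renH ρ ⊥⁻ = ⊥⁻
    Ω⁻-renH ρ (⇒⁻ a b) = ⇒⁻ (Ω⁺-renH ρ a) (Ω⁻-renH ρ b)
    Ω⁻-renH ρ (∀i⁻ a) = ∀i⁻ (Ω⁻-renH ρ a)
    Ω⁻-renH ρ (∀p⁻ {A = A} a X∉A) =
      ∀p⁻ (Ω⁻-renH (liftH {S = S} ρ) a)
          (λ o → X∉A (occ-renH-back (liftH {S = S} ρ) here A (here-onlyPreimage ρ) o))

  mutual
    Ω⁺-renH⁻¹ : ∀ {Δ Δ' n} (ρ : HRen {S} Δ Δ') (A : Fm S Δ n) → Ω⁺ (renH ρ A) → Ω⁺ A
    Ω⁺-renH⁻¹ ρ ⊥̇ _ = ⊥⁺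
    Ω⁺-renH⁻¹ ρ (atom h ts) _ = atom⁺ h ts
    Ω⁺-renH⁻¹ ρ (A ⇒ B) (⇒⁺ a b) = ⇒⁺ (Ω⁻-renH⁻¹ ρ A a) (Ω⁺-renH⁻¹ ρ B b)
    Ω⁺-renH⁻¹ ρ (∀i A) (∀i⁺ a) = ∀i⁺ (Ω⁺-renH⁻¹ ρ A a)
    Ω⁺-renH⁻¹ ρ (∀p k A) (∀p⁺ a) = ∀p⁺ (Ω⁺-renH⁻¹ (liftH {S = S} ρ) A a)
    Ω⁺-renH⁻¹ ρ (μ k D ts) (μ⁺ a o p) =
      μ⁺ (Ω⁺-renH⁻¹ (liftH {S = S} ρ) D a)
         (occ-renH-back (liftH {S = S} ρ) here D (here-onlyPreimage ρ) o)
         (pos-renH⁻¹ (liftH {S = S} ρ) here D p)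

    Ω⁻-renH⁻¹ : ∀ {Δ Δ' n} (ρ : HRen {S} Δ Δ') (A : Fm S Δ n) → Ω⁻ (renH ρ A) → Ω⁻ A
    Ω⁻-renH⁻¹ ρ ⊥̇ _ = ⊥⁻
    Ω⁻-renH⁻¹ ρ (atom h ts) _ = atom⁻ h ts
    Ω⁻-renH⁻¹ ρ (A ⇒ B) (⇒⁻ a b) = ⇒⁻ (Ω⁺-renH⁻¹ ρ A a) (Ω⁻-renH⁻¹ ρ B b)
    Ω⁻-renH⁻¹ ρ (∀i A) (∀i⁻ a) = ∀i⁻ (Ω⁻-renH⁻¹ ρ A a)
    Ω⁻-renH⁻¹ ρ (∀p k A) (∀p⁻ a X∉A) =
      ∀p⁻ (Ω⁻-renH⁻¹ (liftH {S = S} ρ) A a) (λ o → X∉A (occ-renH (liftH {S = S} ρ) here A o))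
    Ω⁻-renH⁻¹ ρ (μ k D ts) ()

  -- Substitution of formulas for predicate heads

  absent⇒pos×neg : ∀ {Δ n e} (h : Δ ∋ e) (A : Fm S Δ n) → ¬ Occ h A → Pos h A × Neg h A
  absent⇒pos×neg h ⊥̇ h∉ = tt , tt
  absent⇒pos×neg h (atom h₀ ts) h∉ = tt , ¬T⇒T-not (sameHead h h₀) h∉
  absent⇒pos×neg h (A ⇒ B) h∉
    with absent⇒pos×neg h A (λ o → h∉ (inj₁ o)) | absent⇒pos×neg h B (λ o → h∉ (inj₂ o))
  ... | posA , negA | posB , negB = (negA , posB) , (posA , negB)
  absent⇒pos×neg h (∀i A) h∉ = absent⇒pos×neg h A h∉
  absent⇒pos×neg h (∀p k A) h∉ = absent⇒pos×neg (there h) A h∉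
  absent⇒pos×neg h (μ k D ts) h∉ = absent⇒pos×neg (there h) D h∉

  occ-psubst : ∀ {Δ Δ' n e e'} (A : Fm S Δ n) (σ : PSub {S} Δ Δ' n) (h : Δ ∋ e) (h' : Δ' ∋ e')
             → Occ h A → Occ h' (σ h) → Occ h' (psubst A σ)
  occ-psubst ⊥̇ σ h h' () o'
  occ-psubst (atom h₀ ts) σ h h' o o' with sameHead-sound h h₀ o
  ... | refl = coe⁻ (occ-substF h' (args ts) (σ h)) o'
  occ-psubst (A ⇒ B) σ h h' (inj₁ o) o' = inj₁ (occ-psubst A σ h h' o o')
  occ-psubst (A ⇒ B) σ h h' (inj₂ o) o' = inj₂ (occ-psubst B σ h h' o o')
  occ-psubst (∀i A) σ h h' o o' = occ-psubst A (liftPI 1 σ) h h' o (coe⁻ (occ-substF h' _ (σ h)) o')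
  occ-psubst (∀p k A) σ h h' o o' =
    occ-psubst A (liftPH σ) (there h) (there h') o (occ-renH there h' (σ h) o')
  occ-psubst (μ k D ts) σ h h' o o' =
    occ-psubst D (liftPI k (liftPH σ)) (there h) (there h') o
      (coe⁻ (occ-substF (there h') _ (renH there (σ h))) (occ-renH there h' (σ h) o'))

  Source : ∀ {Δ Δ' n e'} (A : Fm S Δ n) (σ : PSub {S} Δ Δ' n) (h' : Δ' ∋ e') → Set
  Source {Δ} A σ h' = Σ (Kind × ℕ) λ e → Σ (Δ ∋ e) λ h → Occ h A × Occ h' (σ h)

  source-liftPH : ∀ {Δ Δ' n m e' e₁} (A : Fm S (e₁ ∷ Δ) m) (σ : PSub {S} Δ Δ' n) (h' : Δ' ∋ e')
                → ∀ {e₀} (h₀ : (e₁ ∷ Δ) ∋ e₀) → Occ h₀ A → Occ (there h') (liftPH σ h₀)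
                → Σ (Kind × ℕ) λ e → Σ (Δ ∋ e) λ h → Occ (there h) A × Occ h' (σ h)
  source-liftPH A σ h' here o ()
  source-liftPH A σ h' (there h) o o' with occ-renH⁻¹ there (there h') (σ h) o'
  ... | _ , b , ob , s = _ , h , o , sameHead-transport (λ x → Occ x (σ h)) s ob

  occ-psubst⁻¹ : ∀ {Δ Δ' n e'} (A : Fm S Δ n) (σ : PSub {S} Δ Δ' n) (h' : Δ' ∋ e')
               → Occ h' (psubst A σ) → Source A σ h'
  occ-psubst⁻¹ ⊥̇ σ h' ()
  occ-psubst⁻¹ (atom h₀ ts) σ h' o = _ , h₀ , sameHead-refl h₀ , coe (occ-substF h' (args ts) (σ h₀)) o
  occ-psubst⁻¹ (A ⇒ B) σ h' (inj₁ o) with occ-psubst⁻¹ A σ h' o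
  ... | e , h , oA , o' = e , h , inj₁ oA , o'
  occ-psubst⁻¹ (A ⇒ B) σ h' (inj₂ o) with occ-psubst⁻¹ B σ h' o
  ... | e , h , oB , o' = e , h , inj₂ oB , o'
  occ-psubst⁻¹ (∀i A) σ h' o with occ-psubst⁻¹ A (liftPI 1 σ) h' o
  ... | e , h , oA , o' = e , h , oA , coe (occ-substF h' _ (σ h)) o'
  occ-psubst⁻¹ (∀p k A) σ h' o with occ-psubst⁻¹ A (liftPH σ) (there h') o
  ... | _ , h₀ , oA , o' = source-liftPH A σ h' h₀ oA o'
  occ-psubst⁻¹ (μ k D ts) σ h' o with occ-psubst⁻¹ D (liftPI k (liftPH σ)) (there h') o
  ... | _ , h₀ , oD , o' = source-liftPH D σ h' h₀ oD (coe (occ-substF (there h') _ (liftPH σ h₀)) o')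

  mutual
    pos-psubst⁻¹ : ∀ {Δ Δ' n e e'} (A : Fm S Δ n) (σ : PSub {S} Δ Δ' n) (h : Δ ∋ e) (h' : Δ' ∋ e')
                 → ¬ Neg h' (σ h) → Pos h' (psubst A σ) → Pos h A
    pos-psubst⁻¹ ⊥̇ σ h h' ¬neg p = tt
    pos-psubst⁻¹ (atom h₀ ts) σ h h' ¬neg p = tt
    pos-psubst⁻¹ (A ⇒ B) σ h h' ¬neg (n , p) = neg-psubst⁻¹ A σ h h' ¬neg n , pos-psubst⁻¹ B σ h h' ¬neg p
    pos-psubst⁻¹ (∀i A) σ h h' ¬neg p = pos-psubst⁻¹ A (liftPI 1 σ) h h' (¬neg-liftPI 1 σ h h' ¬neg) p
    pos-psubst⁻¹ (∀p k A) σ h h' ¬neg p =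
      pos-psubst⁻¹ A (liftPH σ) (there h) (there h') (¬neg-liftPH σ h h' ¬neg) p
    pos-psubst⁻¹ (μ k D ts) σ h h' ¬neg p =
      pos-psubst⁻¹ D (liftPI k (liftPH σ)) (there h) (there h')
        (¬neg-liftPI k (liftPH σ) (there h) (there h') (¬neg-liftPH σ h h' ¬neg)) p

    neg-psubst⁻¹ : ∀ {Δ Δ' n e e'} (A : Fm S Δ n) (σ : PSub {S} Δ Δ' n) (h : Δ ∋ e) (h' : Δ' ∋ e')
                 → ¬ Neg h' (σ h) → Neg h' (psubst A σ) → Neg h A
    neg-psubst⁻¹ ⊥̇ σ h h' ¬neg p = tt
    neg-psubst⁻¹ (atom h₀ ts) σ h h' ¬neg p with T? (sameHead h h₀)
    ... | no ¬s = ¬T⇒T-not (sameHead h h₀) ¬s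
    ... | yes s with sameHead-sound h h₀ s
    ...   | refl = ⊥-elim (¬neg (coe (neg-substF h' (args ts) (σ h)) p))
    neg-psubst⁻¹ (A ⇒ B) σ h h' ¬neg (n , p) = pos-psubst⁻¹ A σ h h' ¬neg n , neg-psubst⁻¹ B σ h h' ¬neg p
    neg-psubst⁻¹ (∀i A) σ h h' ¬neg p = neg-psubst⁻¹ A (liftPI 1 σ) h h' (¬neg-liftPI 1 σ h h' ¬neg) p
    neg-psubst⁻¹ (∀p k A) σ h h' ¬neg p =
      neg-psubst⁻¹ A (liftPH σ) (there h) (there h') (¬neg-liftPH σ h h' ¬neg) p
    neg-psubst⁻¹ (μ k D ts) σ h h' ¬neg p =
      neg-psubst⁻¹ D (liftPI k (liftPH σ)) (there h) (there h')
        (¬neg-liftPI k (liftPH σ) (there h) (there h') (¬neg-liftPH σ h h' ¬neg)) p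

    ¬neg-liftPI : ∀ {Δ Δ' n e e'} (k : ℕ) (σ : PSub {S} Δ Δ' n) (h : Δ ∋ e) (h' : Δ' ∋ e')
                → ¬ Neg h' (σ h) → ¬ Neg h' (liftPI k σ h)
    ¬neg-liftPI k σ h h' ¬neg n = ¬neg (coe (neg-substF h' _ (σ h)) n)

    ¬neg-liftPH : ∀ {Δ Δ' n e e' e₁} (σ : PSub {S} Δ Δ' n) (h : Δ ∋ e) (h' : Δ' ∋ e')
                → ¬ Neg h' (σ h) → ¬ Neg (there h') (liftPH {e' = e₁} σ (there h))
    ¬neg-liftPH σ h h' ¬neg n = ¬neg (neg-renH⁻¹ there h' (σ h) n)

  PositiveImages : ∀ {Δ Δ' n e e'} (σ : PSub {S} Δ Δ' n) (h : Δ ∋ e) (h' : Δ' ∋ e') → Set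
  PositiveImages {Δ} σ h h' =
    ∀ {e₀} (h₀ : Δ ∋ e₀) → Pos h' (σ h₀) × (T (not (sameHead h h₀)) → Neg h' (σ h₀))

  positiveImages-liftPI : ∀ {Δ Δ' n e e'} (k : ℕ) (σ : PSub {S} Δ Δ' n) (h : Δ ∋ e) (h' : Δ' ∋ e')
                        → PositiveImages σ h h' → PositiveImages (liftPI k σ) h h'
  positiveImages-liftPI k σ h h' im h₀ =
    coe⁻ (pos-substF h' _ (σ h₀)) (proj₁ (im h₀)) , λ t → coe⁻ (neg-substF h' _ (σ h₀)) (proj₂ (im h₀) t)

  positiveImages-liftPH : ∀ {Δ Δ' n e e' e₁} (σ : PSub {S} Δ Δ' n) (h : Δ ∋ e) (h' : Δ' ∋ e')
                        → PositiveImages σ h h' → PositiveImages (liftPH {e' = e₁} σ) (there h) (there h')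
  positiveImages-liftPH σ h h' im here = tt , λ _ → tt
  positiveImages-liftPH σ h h' im (there h₀) =
    pos-renH there h' (there h') (σ h₀) (λ b s → s) (proj₁ (im h₀)) ,
    λ t → neg-renH there h' (there h') (σ h₀) (λ b s → s) (proj₂ (im h₀) t)

  mutual
    pos-psubst : ∀ {Δ Δ' n e e'} (A : Fm S Δ n) (σ : PSub {S} Δ Δ' n) (h : Δ ∋ e) (h' : Δ' ∋ e')
               → PositiveImages σ h h' → Pos h A → Pos h' (psubst A σ)
    pos-psubst ⊥̇ σ h h' im p = tt
    pos-psubst (atom h₀ ts) σ h h' im p = coe⁻ (pos-substF h' (args ts) (σ h₀)) (proj₁ (im h₀))
    pos-psubst (A ⇒ B) σ h h' im (n , p) = neg-psubst A σ h h' im n , pos-psubst B σ h h' im p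
    pos-psubst (∀i A) σ h h' im p = pos-psubst A (liftPI 1 σ) h h' (positiveImages-liftPI 1 σ h h' im) p
    pos-psubst (∀p k A) σ h h' im p =
      pos-psubst A (liftPH σ) (there h) (there h') (positiveImages-liftPH σ h h' im) p
    pos-psubst (μ k D ts) σ h h' im p =
      pos-psubst D (liftPI k (liftPH σ)) (there h) (there h')
        (positiveImages-liftPI k (liftPH σ) (there h) (there h') (positiveImages-liftPH σ h h' im)) p

    neg-psubst : ∀ {Δ Δ' n e e'} (A : Fm S Δ n) (σ : PSub {S} Δ Δ' n) (h : Δ ∋ e) (h' : Δ' ∋ e')
               → PositiveImages σ h h' → Neg h A → Neg h' (psubst A σ)
    neg-psubst ⊥̇ σ h h' im p = tt
    neg-psubst (atom h₀ ts) σ h h' im p = coe⁻ (neg-substF h' (args ts) (σ h₀)) (proj₂ (im h₀) p)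
    neg-psubst (A ⇒ B) σ h h' im (n , p) = pos-psubst A σ h h' im n , neg-psubst B σ h h' im p
    neg-psubst (∀i A) σ h h' im p = neg-psubst A (liftPI 1 σ) h h' (positiveImages-liftPI 1 σ h h' im) p
    neg-psubst (∀p k A) σ h h' im p =
      neg-psubst A (liftPH σ) (there h) (there h') (positiveImages-liftPH σ h h' im) p
    neg-psubst (μ k D ts) σ h h' im p =
      neg-psubst D (liftPI k (liftPH σ)) (there h) (there h')
        (positiveImages-liftPI k (liftPH σ) (there h) (there h') (positiveImages-liftPH σ h h' im)) p

  -- Under the μ-binder C of μ C x̄ D, the substitution lifted twice maps C to
  -- C(x̄) and every outer head to a formula in which C is absent.
  μ-binder-occ⁻¹ : ∀ {Δ Δ' n} (k : ℕ) (σ : PSub {S} Δ Δ' n) (D : Fm S ((psym , k) ∷ Δ) (k + n))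
                 → Occ here (psubst D (liftPI k (liftPH σ))) → Occ here D
  μ-binder-occ⁻¹ k σ D o with occ-psubst⁻¹ D (liftPI k (liftPH σ)) here o
  ... | _ , here , oD , _ = oD
  ... | _ , there h , _ , o' = ⊥-elim (here∉weaken (σ h) (coe (occ-substF here _ (renH there (σ h))) o'))

  μ-binder-positiveImages : ∀ {Δ Δ' n} (k : ℕ) (σ : PSub {S} Δ Δ' n)
                          → PositiveImages (liftPI k (liftPH {e' = (psym , k)} σ)) here here
  μ-binder-positiveImages k σ here = tt , λ ()
  μ-binder-positiveImages k σ (there h) =
    coe⁻ (pos-substF here _ (renH there (σ h))) (proj₁ C-absent) ,
    λ _ → coe⁻ (neg-substF here _ (renH there (σ h))) (proj₂ C-absent)
    where
      C-absent : Pos here (renH there (σ h)) × Neg here (renH there (σ h))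
      C-absent = absent⇒pos×neg here (renH there (σ h)) (here∉weaken (σ h))

  mutual
    Ω⁺-psubst⁻¹ : ∀ {Δ Δ' n} (A : Fm S Δ n) (σ : PSub {S} Δ Δ' n) → Ω⁺ (psubst A σ) → Ω⁺ A
    Ω⁺-psubst⁻¹ ⊥̇ σ _ = ⊥⁺
    Ω⁺-psubst⁻¹ (atom h ts) σ _ = atom⁺ h ts
    Ω⁺-psubst⁻¹ (A ⇒ B) σ (⇒⁺ a b) = ⇒⁺ (Ω⁻-psubst⁻¹ A σ a) (Ω⁺-psubst⁻¹ B σ b)
    Ω⁺-psubst⁻¹ (∀i A) σ (∀i⁺ a) = ∀i⁺ (Ω⁺-psubst⁻¹ A (liftPI 1 σ) a)
    Ω⁺-psubst⁻¹ (∀p k A) σ (∀p⁺ a) = ∀p⁺ (Ω⁺-psubst⁻¹ A (liftPH σ) a)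
    Ω⁺-psubst⁻¹ (μ k D ts) σ (μ⁺ a o p) =
      μ⁺ (Ω⁺-psubst⁻¹ D (liftPI k (liftPH σ)) a) (μ-binder-occ⁻¹ k σ D o)
         (pos-psubst⁻¹ D (liftPI k (liftPH σ)) here here (λ ()) p)

    Ω⁻-psubst⁻¹ : ∀ {Δ Δ' n} (A : Fm S Δ n) (σ : PSub {S} Δ Δ' n) → Ω⁻ (psubst A σ) → Ω⁻ A
    Ω⁻-psubst⁻¹ ⊥̇ σ _ = ⊥⁻
    Ω⁻-psubst⁻¹ (atom h ts) σ _ = atom⁻ h ts
    Ω⁻-psubst⁻¹ (A ⇒ B) σ (⇒⁻ a b) = ⇒⁻ (Ω⁺-psubst⁻¹ A σ a) (Ω⁻-psubst⁻¹ B σ b)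
    Ω⁻-psubst⁻¹ (∀i A) σ (∀i⁻ a) = ∀i⁻ (Ω⁻-psubst⁻¹ A (liftPI 1 σ) a)
    Ω⁻-psubst⁻¹ (∀p k A) σ (∀p⁻ a X∉) =
      ∀p⁻ (Ω⁻-psubst⁻¹ A (liftPH σ) a) (λ o → X∉ (occ-psubst A (liftPH σ) here here o tt))
    Ω⁻-psubst⁻¹ (μ k D ts) σ ()

  IsAtom : ∀ {Δ n} → Fm S Δ n → Set
  IsAtom (atom _ _) = ⊤
  IsAtom _ = ⊥

  atom-Ω : ∀ {Δ n} (X : Fm S Δ n) → IsAtom X → Ω⁺ X × Ω⁻ X
  atom-Ω (atom h ts) _ = atom⁺ h ts , atom⁻ h ts

  isAtom-substF : ∀ {Δ m n} (σ : Fin m → Term S n) (X : Fm S Δ m) → IsAtom X → IsAtom (substF σ X)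
  isAtom-substF σ (atom _ _) _ = tt

  isAtom-renH : ∀ {Δ Δ' n} (ρ : HRen {S} Δ Δ') (X : Fm S Δ n) → IsAtom X → IsAtom (renH ρ X)
  isAtom-renH ρ (atom _ _) _ = tt

  AtomsBesides : ∀ {Δ Δ' n e} (σ : PSub {S} Δ Δ' n) (h : Δ ∋ e) → Set
  AtomsBesides {Δ} σ h = ∀ {e₀} (h₀ : Δ ∋ e₀) → T (not (sameHead h h₀)) → IsAtom (σ h₀)

  atomsBesides-liftPI : ∀ {Δ Δ' n e} (k : ℕ) (σ : PSub {S} Δ Δ' n) (h : Δ ∋ e)
                      → AtomsBesides σ h → AtomsBesides (liftPI k σ) h
  atomsBesides-liftPI k σ h atoms h₀ t = isAtom-substF _ (σ h₀) (atoms h₀ t)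

  atomsBesides-liftPH : ∀ {Δ Δ' n e e₁} (σ : PSub {S} Δ Δ' n) (h : Δ ∋ e)
                      → AtomsBesides σ h → AtomsBesides (liftPH {e' = e₁} σ) (there h)
  atomsBesides-liftPH σ h atoms here t = tt
  atomsBesides-liftPH σ h atoms (there h₀) t = isAtom-renH there (σ h₀) (atoms h₀ t)

  mutual
    Ω⁺-psubst : ∀ {Δ Δ' n e} (A : Fm S Δ n) (σ : PSub {S} Δ Δ' n) (h : Δ ∋ e)
              → Ω⁺ A → Pos h A → (Occ h A → Ω⁺ (σ h)) → AtomsBesides σ h → Ω⁺ (psubst A σ)
    Ω⁺-psubst ⊥̇ σ h _ _ _ _ = ⊥⁺
    Ω⁺-psubst (atom h₀ ts) σ h a p img atoms with T? (sameHead h h₀)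
    ... | no ¬s = Ω⁺-substF (args ts) (proj₁ (atom-Ω (σ h₀) (atoms h₀ (¬T⇒T-not _ ¬s))))
    ... | yes s with sameHead-sound h h₀ s
    ...   | refl = Ω⁺-substF (args ts) (img s)
    Ω⁺-psubst (A ⇒ B) σ h (⇒⁺ a b) (n , p) img atoms =
      ⇒⁺ (Ω⁻-psubst A σ h a n (λ o → img (inj₁ o)) atoms) (Ω⁺-psubst B σ h b p (λ o → img (inj₂ o)) atoms)
    Ω⁺-psubst (∀i A) σ h (∀i⁺ a) p img atoms =
      ∀i⁺ (Ω⁺-psubst A (liftPI 1 σ) h a p (λ o → Ω⁺-substF _ (img o)) (atomsBesides-liftPI 1 σ h atoms))
    Ω⁺-psubst (∀p k A) σ h (∀p⁺ a) p img atoms =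
      ∀p⁺ (Ω⁺-psubst A (liftPH σ) (there h) a p (λ o → Ω⁺-renH there (img o)) (atomsBesides-liftPH σ h atoms))
    Ω⁺-psubst (μ k D ts) σ h (μ⁺ a o pD) p img atoms =
      μ⁺ (Ω⁺-psubst D (liftPI k (liftPH σ)) (there h) a p (λ o' → Ω⁺-substF _ (Ω⁺-renH there (img o')))
            (atomsBesides-liftPI k (liftPH σ) (there h) (atomsBesides-liftPH σ h atoms)))
         (occ-psubst D (liftPI k (liftPH σ)) here here o tt)
         (pos-psubst D (liftPI k (liftPH σ)) here here (μ-binder-positiveImages k σ) pD)

    Ω⁻-psubst : ∀ {Δ Δ' n e} (A : Fm S Δ n) (σ : PSub {S} Δ Δ' n) (h : Δ ∋ e)
              → Ω⁻ A → Neg h A → (Occ h A → Ω⁺ (σ h)) → AtomsBesides σ h → Ω⁻ (psubst A σ)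
    Ω⁻-psubst ⊥̇ σ h _ _ _ _ = ⊥⁻
    Ω⁻-psubst (atom h₀ ts) σ h a t img atoms = Ω⁻-substF (args ts) (proj₂ (atom-Ω (σ h₀) (atoms h₀ t)))
    Ω⁻-psubst (A ⇒ B) σ h (⇒⁻ a b) (p , n) img atoms =
      ⇒⁻ (Ω⁺-psubst A σ h a p (λ o → img (inj₁ o)) atoms) (Ω⁻-psubst B σ h b n (λ o → img (inj₂ o)) atoms)
    Ω⁻-psubst (∀i A) σ h (∀i⁻ a) n img atoms =
      ∀i⁻ (Ω⁻-psubst A (liftPI 1 σ) h a n (λ o → Ω⁺-substF _ (img o)) (atomsBesides-liftPI 1 σ h atoms))
    Ω⁻-psubst (∀p k A) σ h (∀p⁻ a X∉A) n img atoms =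
      ∀p⁻ (Ω⁻-psubst A (liftPH σ) (there h) a n (λ o → Ω⁺-renH there (img o)) (atomsBesides-liftPH σ h atoms))
          X∉
      where
        X∉ : ¬ Occ here (psubst A (liftPH σ))
        X∉ o with occ-psubst⁻¹ A (liftPH σ) here o
        ... | _ , here , oA , _ = X∉A oA
        ... | _ , there h₁ , _ , o' = here∉weaken (σ h₁) o'
    Ω⁻-psubst (μ k D ts) σ h () n img atoms

  -- A μ put at a positive place never yields a ∀-negative formula (nor, at
  -- a negative place, a ∀-positive one): Ω⁻ has no μ, and in Ω⁺ a negative
  -- place lies inside an Ω⁻ part.
  IsMu : ∀ {Δ n} → Fm S Δ n → Set
  IsMu (μ _ _ _) = ⊤
  IsMu _ = ⊥

  isMu-substF : ∀ {Δ m n} (σ : Fin m → Term S n) (X : Fm S Δ m) → IsMu X → IsMu (substF σ X)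
  isMu-substF σ (μ _ _ _) _ = tt

  isMu-renH : ∀ {Δ Δ' n} (ρ : HRen {S} Δ Δ') (X : Fm S Δ n) → IsMu X → IsMu (renH ρ X)
  isMu-renH ρ (μ _ _ _) _ = tt

  μ∉Ω⁻ : ∀ {Δ n} (X : Fm S Δ n) → IsMu X → ¬ Ω⁻ X
  μ∉Ω⁻ (μ _ _ _) _ ()

  mutual
    μ-at-pos-∉Ω⁻ : ∀ {Δ Δ' n e} (A : Fm S Δ n) (σ : PSub {S} Δ Δ' n) (h : Δ ∋ e)
                 → Occ h A → Pos h A → IsMu (σ h) → ¬ Ω⁻ (psubst A σ)
    μ-at-pos-∉Ω⁻ ⊥̇ σ h () p m x
    μ-at-pos-∉Ω⁻ (atom h₀ ts) σ h o p m x with sameHead-sound h h₀ o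
    ... | refl = μ∉Ω⁻ (substF (args ts) (σ h)) (isMu-substF _ (σ h) m) x
    μ-at-pos-∉Ω⁻ (A ⇒ B) σ h (inj₁ o) (n , p) m (⇒⁻ a b) = μ-at-neg-∉Ω⁺ A σ h o n m a
    μ-at-pos-∉Ω⁻ (A ⇒ B) σ h (inj₂ o) (n , p) m (⇒⁻ a b) = μ-at-pos-∉Ω⁻ B σ h o p m b
    μ-at-pos-∉Ω⁻ (∀i A) σ h o p m (∀i⁻ a) = μ-at-pos-∉Ω⁻ A (liftPI 1 σ) h o p (isMu-substF _ (σ h) m) a
    μ-at-pos-∉Ω⁻ (∀p k A) σ h o p m (∀p⁻ a _) =
      μ-at-pos-∉Ω⁻ A (liftPH σ) (there h) o p (isMu-renH there (σ h) m) a
    μ-at-pos-∉Ω⁻ (μ k D ts) σ h o p m ()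

    μ-at-neg-∉Ω⁺ : ∀ {Δ Δ' n e} (A : Fm S Δ n) (σ : PSub {S} Δ Δ' n) (h : Δ ∋ e)
                 → Occ h A → Neg h A → IsMu (σ h) → ¬ Ω⁺ (psubst A σ)
    μ-at-neg-∉Ω⁺ ⊥̇ σ h () n m x
    μ-at-neg-∉Ω⁺ (atom h₀ ts) σ h o n m x = T-not-absurd _ o n
    μ-at-neg-∉Ω⁺ (A ⇒ B) σ h (inj₁ o) (p , n) m (⇒⁺ a b) = μ-at-pos-∉Ω⁻ A σ h o p m a
    μ-at-neg-∉Ω⁺ (A ⇒ B) σ h (inj₂ o) (p , n) m (⇒⁺ a b) = μ-at-neg-∉Ω⁺ B σ h o n m b
    μ-at-neg-∉Ω⁺ (∀i A) σ h o n m (∀i⁺ a) = μ-at-neg-∉Ω⁺ A (liftPI 1 σ) h o n (isMu-substF _ (σ h) m) a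
    μ-at-neg-∉Ω⁺ (∀p k A) σ h o n m (∀p⁺ a) =
      μ-at-neg-∉Ω⁺ A (liftPH σ) (there h) o n (isMu-renH there (σ h) m) a
    μ-at-neg-∉Ω⁺ (μ k D ts) σ h o n m (μ⁺ a _ _) =
      μ-at-neg-∉Ω⁺ D (liftPI k (liftPH σ)) (there h) o n (isMu-substF _ _ (isMu-renH there (σ h) m)) a

  -- The substitution A[G/X] of the ∀-left rule

  Ω⁺-[/X]⁻¹ : ∀ {Δ n κ k} (A : Fm S ((κ , k) ∷ Δ) n) (G : Fm S Δ (k + n)) → Ω⁺ (A [ G /X]) → Ω⁺ A
  Ω⁺-[/X]⁻¹ A G = Ω⁺-psubst⁻¹ A _

  Ω⁻-[/X] : ∀ {Δ n κ k} (A : Fm S ((κ , k) ∷ Δ) n) (G : Fm S Δ (k + n))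
          → Ω⁻ A → ¬ Occ here A → Ω⁻ (A [ G /X])
  Ω⁻-[/X] A G a X∉A =
    Ω⁻-psubst A _ here a (proj₂ (absent⇒pos×neg here A X∉A)) (λ o → ⊥-elim (X∉A o)) λ { (there h) _ → tt }

  occ-[/X] : ∀ {Δ n κ k e} (A : Fm S ((κ , k) ∷ Δ) n) (G : Fm S Δ (k + n)) (h : Δ ∋ e)
           → Occ (there h) A → Occ h (A [ G /X])
  occ-[/X] A G h o = occ-psubst A _ (there h) h o (sameHead-refl h)

  occ-[/X]⁻¹ : ∀ {Δ n κ k e} (A : Fm S ((κ , k) ∷ Δ) n) (G : Fm S Δ (k + n)) (h : Δ ∋ e)
             → (Occ here A → Occ h G → Occ (there h) A) → Occ h (A [ G /X]) → Occ (there h) A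
  occ-[/X]⁻¹ A G h viaG o with occ-psubst⁻¹ A _ h o
  ... | _ , here , oA , oG = viaG oA oG
  ... | _ , there h₁ , oA , s = sameHead-transport (λ x → Occ (there x) A) s oA

  -- The unfolding D[μ/C] of the μ-rules

  -- D with μ C x̄ D ⟨x̄⟩ substituted for C(x̄)
  unfold : ∀ {Δ n} (k : ℕ) → Fm S ((psym , k) ∷ Δ) (k + n) → Fm S Δ (k + n)
  unfold k D = D [ absF k (μz k D) /X]

  Ω⁺-unfold : ∀ {Δ n k} (D : Fm S ((psym , k) ∷ Δ) (k + n))
            → Ω⁺ D → Occ here D → Pos here D → Ω⁺ (unfold k D)
  Ω⁺-unfold {k = k} D d o p = Ω⁺-psubst D _ here d p (λ _ → Ω⁺-substF _ μD) λ { (there h) _ → tt }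
    where
      μD : Ω⁺ (μz k D)
      μD = μ⁺ (Ω⁺-substF _ d) (coe⁻ (occ-substF here _ D) o) (coe⁻ (pos-substF here _ D) p)

  unfold-∉Ω⁻ : ∀ {Δ n k} (D : Fm S ((psym , k) ∷ Δ) (k + n))
             → Occ here D → Pos here D → ¬ Ω⁻ (unfold k D)
  unfold-∉Ω⁻ D o p = μ-at-pos-∉Ω⁻ D _ here o p tt

  occ-unfold⁻¹ : ∀ {Δ n k e} (D : Fm S ((psym , k) ∷ Δ) (k + n)) (h : Δ ∋ e)
               → Occ h (unfold k D) → Occ (there h) D
  occ-unfold⁻¹ {k = k} D h =
    occ-[/X]⁻¹ D _ h λ _ o → coe (occ-substF (there h) _ D) (coe (occ-substF h _ (μz k D)) o)

  -- The invariant, closed under every rule of ⊆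

  -- every free predicate head of A is free in B (A and B may differ in scope)
  Heads⊆ : ∀ {Δ m n} → Fm S Δ m → Fm S Δ n → Set
  Heads⊆ {Δ} A B = ∀ {e} (h : Δ ∋ e) → Occ h A → Occ h B

  Transfers : ∀ {Δ m n} → Fm S Δ m → Fm S Δ n → Set
  Transfers X Y = (Ω⁻ X → Ω⁻ Y × Heads⊆ Y X) × (Ω⁺ Y → Ω⁺ X × Heads⊆ X Y)

  transfers-refl : ∀ {Δ n} (A : Fm S Δ n) → Transfers A A
  transfers-refl A = (λ a → a , λ {_} h o → o) , (λ a → a , λ {_} h o → o)

  transfers-trans : ∀ {Δ l m n} {A : Fm S Δ l} {B : Fm S Δ m} {C : Fm S Δ n}
                  → Transfers A B → Transfers B C → Transfers A C
  transfers-trans {A = A} {C = C} (neg₁ , pos₁) (neg₂ , pos₂) = neg , pos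
    where
      neg : Ω⁻ A → Ω⁻ C × Heads⊆ C A
      neg a = let b , fvB = neg₁ a ; c , fvC = neg₂ b in c , λ h o → fvB h (fvC h o)
      pos : Ω⁺ C → Ω⁺ A × Heads⊆ A C
      pos c = let b , fvB = pos₂ c ; a , fvA = pos₁ b in a , λ h o → fvB h (fvA h o)

  transfers-arr : ∀ {Δ n} {A A' B B' : Fm S Δ n}
                → Transfers A A' → Transfers B B' → Transfers (A' ⇒ B) (A ⇒ B')
  transfers-arr (negA , posA) (negB , posB) = neg , pos
    where
      neg : Ω⁻ _ → _
      neg (⇒⁻ a' b) with posA a' | negB b
      ... | a , fvA | b' , fvB' = ⇒⁻ a b' , λ { h (inj₁ o) → inj₁ (fvA h o) ; h (inj₂ o) → inj₂ (fvB' h o) }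
      pos : Ω⁺ _ → _
      pos (⇒⁺ a b') with negA a | posB b'
      ... | a' , fvA' | b , fvB = ⇒⁺ a' b , λ { h (inj₁ o) → inj₁ (fvA' h o) ; h (inj₂ o) → inj₂ (fvB h o) }

  transfers-substF : ∀ {Δ m n} (σ : Fin m → Term S n) (A : Fm S Δ m) → Transfers A (substF σ A)
  transfers-substF σ A =
    (λ a → Ω⁻-substF σ a , λ {_} h o → coe (occ-substF h σ A) o) ,
    (λ a → Ω⁺-substF⁻¹ σ A a , λ {_} h o → coe⁻ (occ-substF h σ A) o)

  transfers-substF⁻¹ : ∀ {Δ m n} (σ : Fin m → Term S n) (A : Fm S Δ m) → Transfers (substF σ A) A
  transfers-substF⁻¹ σ A =
    (λ a → Ω⁻-substF⁻¹ σ A a , λ {_} h o → coe⁻ (occ-substF h σ A) o) ,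
    (λ a → Ω⁺-substF σ a , λ {_} h o → coe (occ-substF h σ A) o)

  transfers-∀i : ∀ {Δ n} (A : Fm S Δ (suc n)) → Transfers (∀i A) A
  transfers-∀i A = (λ { (∀i⁻ a) → a , λ {_} h o → o }) , (λ a → ∀i⁺ a , λ {_} h o → o)

  transfers-∀i⁻¹ : ∀ {Δ n} (A : Fm S Δ (suc n)) → Transfers A (∀i A)
  transfers-∀i⁻¹ A = (λ a → ∀i⁻ a , λ {_} h o → o) , (λ { (∀i⁺ a) → a , λ {_} h o → o })

  transfers-∀Lp : ∀ {Δ n k} (A : Fm S ((pvar , k) ∷ Δ) n) {B : Fm S Δ n} (G : Fm S Δ (k + n))
                → Transfers (A [ G /X]) B → Transfers (∀p k A) B
  transfers-∀Lp A G (neg , pos) = neg' , pos'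
    where
      neg' : Ω⁻ (∀p _ A) → _
      neg' (∀p⁻ a X∉A) =
        let b , fv = neg (Ω⁻-[/X] A G a X∉A)
        in b , λ {_} h o → occ-[/X]⁻¹ A G h (λ oX → ⊥-elim (X∉A oX)) (fv h o)
      pos' : Ω⁺ _ → _
      pos' b = let s , fv = pos b in ∀p⁺ (Ω⁺-[/X]⁻¹ A G s) , λ {_} h o → fv h (occ-[/X] A G h o)

  transfers-∀Rp : ∀ {Δ n k} (A : Fm S Δ n) {B : Fm S ((pvar , k) ∷ Δ) n}
                → Transfers (renH there A) B → Transfers A (∀p k B)
  transfers-∀Rp A (neg , pos) = neg' , pos'
    where
      neg' : Ω⁻ A → _
      neg' a =
        let b , fv = neg (Ω⁻-renH there a)
        in ∀p⁻ b (λ o → here∉weaken A (fv here o)) ,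
           λ {_} h o → occ-renH-back there h A (λ _ s → s) (fv (there h) o)
      pos' : Ω⁺ (∀p _ _) → _
      pos' (∀p⁺ b) = let s , fv = pos b in Ω⁺-renH⁻¹ there A s , λ {_} h o → fv (there h) (occ-renH there h A o)

  transfers-unfold : ∀ {Δ n k} (D : Fm S ((psym , k) ∷ Δ) (k + n)) (ts : Vec (Term S n) k)
                   → Occ here D → Pos here D → Transfers (unfold k D) (μ k D ts)
  transfers-unfold D ts oD pD = (λ x → ⊥-elim (unfold-∉Ω⁻ D oD pD x)) , pos
    where
      pos : Ω⁺ (μ _ _ _) → _
      pos (μ⁺ d o p) = Ω⁺-unfold D d o p , occ-unfold⁻¹ D

  transfers-μ-left : ∀ {Δ n k} (D : Fm S ((psym , k) ∷ Δ) (k + n)) (G : Fm S Δ (k + (k + n)))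
                     (F : Fm S Δ (k + n)) (ts : Vec (Term S n) k) → Occ here D → Pos here D
                   → (Ω⁺ F → Ω⁺ (D [ G /X]) × Heads⊆ (D [ G /X]) F)
                   → Transfers (μ k D ts) F
  transfers-μ-left D G F ts oD pD pullback = (λ ()) , pos
    where
      pos : Ω⁺ F → _
      pos f = let s , fv = pullback f in μ⁺ (Ω⁺-[/X]⁻¹ D G s) oD pD , λ {_} h o → fv h (occ-[/X] D G h o)

  ⊆-transfers : (E : Eqns S) {Δ : PCtx} {n : ℕ} {X Y : Fm S Δ n} → _⊆_ E X Y → Transfers X Y
  ⊆-transfers E (ax {A = A} _) = transfers-refl A
  ⊆-transfers E (arr _ _ d₁ d₂) = transfers-arr (⊆-transfers E d₁) (⊆-transfers E d₂)
  ⊆-transfers E (∀Li {A = A} u _ _ d) =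
    transfers-trans (transfers-∀i A) (transfers-trans (transfers-substF (sub0 u) A) (⊆-transfers E d))
  ⊆-transfers E (∀Lp {A = A} G _ _ _ d) = transfers-∀Lp A G (⊆-transfers E d)
  ⊆-transfers E (∀Ri {A = A} {B = B} _ _ d) =
    transfers-trans (transfers-substF _ A) (transfers-trans (⊆-transfers E d) (transfers-∀i⁻¹ B))
  ⊆-transfers E (∀Rp {A = A} _ _ d) = transfers-∀Rp A (⊆-transfers E d)
  ⊆-transfers E (eqn B u w _ _ _ d) =
    transfers-trans (⊆-transfers E d)
      (transfers-trans (transfers-substF⁻¹ (sub0 u) B) (transfers-substF (sub0 w) B))
  ⊆-transfers E (tr _ _ d₁ d₂) = transfers-trans (⊆-transfers E d₁) (⊆-transfers E d₂)
  ⊆-transfers E (μd {k = k} D ts _ (oD , pD , _)) =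
    transfers-trans (transfers-substF⁻¹ (args ts) (unfold k D)) (transfers-unfold D ts oD pD)
  ⊆-transfers E (μg' {k = k} D ts (oD , pD , _) _) =
    transfers-trans (transfers-μ-left D (absF k (μz k D)) (unfold k D) ts oD pD (proj₂ (transfers-refl (unfold k D))))
      (transfers-substF (args ts) (unfold k D))
  ⊆-transfers E (μg {k = k} D F ts (oD , pD , _) _ d) =
    transfers-trans (transfers-μ-left D (absF k F) F ts oD pD (proj₂ (⊆-transfers E d)))
      (transfers-substF (args ts) F)

theorem5p1 : (S : Sig) (E : Eqns S) {Δ : PCtx} {n : ℕ}
    (T⁻ T⁺ : Fm S Δ n) → Ω⁻ T⁻ → Ω⁺ T⁺ →
    ((A : Fm S Δ n) → _⊆_ E T⁻ A → Ω⁻ A × Fv₂⊆ A T⁻)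
    × ((B : Fm S Δ n) → _⊆_ E B T⁺ → Ω⁺ B × Fv₂⊆ B T⁺)
theorem5p1 S E T⁻ T⁺ t⁻ t⁺ =
  (λ A d → proj₁ (⊆-transfers E d) t⁻) , (λ B d → proj₂ (⊆-transfers E d) t⁺)
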